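{- Let $m\le n$ and let $c$ be a coloring of $[m]\times[n]$ with no rainbow solution to $x_1+x_2=x_3$. Then for every diagonal $D_x$ with $x\ne m$, $|c(D_x)\setminus c(D_m)|\le 1$.
   Context: $[m]\times[n]=\{(i,j)\in\mathbb{Z}^2:1\le i\le m,1\le j\le n\}$ with componentwise addition. A coloring is a map $c$ from $[m]\times[n]$ to a finite set of colors; a rainbow solution is a triple $\alpha,\beta,\gamma$ with $\alpha+\beta=\gamma$ and pairwise distinct colors. For $1\le k\le m+n-1$, $D_k=\{(i,j)\in[m]\times[n]:m-k=i-j\}$; $D_m$ is the main diagonal; $c(X)=\{c(x):x\in X\}$. -}

module Defs where

open import Data.Nat using (ℕ; _+_; _≤_)
open import Data.Fin using (Fin)
open import Data.Product using (_×_; Σ; ∃; _,_)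
open import Relation.Binary.PropositionalEquality using (_≡_; _≢_)
open import Relation.Nullary using (¬_)

InGrid : ℕ → ℕ → ℕ → ℕ → Set
InGrid m n i j = (1 ≤ i × i ≤ m) × (1 ≤ j × j ≤ n)

-- A coloring of [m]×[n] with r colors (the finite color set is Fin r);
-- values outside the grid are irrelevant.
Coloring : ℕ → Set
Coloring r = ℕ → ℕ → Fin r

RainbowSolution : (m n : ℕ) {r : ℕ} → Coloring r → Set
RainbowSolution m n c =
  Σ ℕ λ a₁ → Σ ℕ λ a₂ → Σ ℕ λ b₁ → Σ ℕ λ b₂ →
    InGrid m n a₁ a₂ × InGrid m n b₁ b₂ × InGrid m n (a₁ + b₁) (a₂ + b₂) ×
    c a₁ a₂ ≢ c b₁ b₂ × c a₁ a₂ ≢ c (a₁ + b₁) (a₂ + b₂) ×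
    c b₁ b₂ ≢ c (a₁ + b₁) (a₂ + b₂)

-- (i , j) ∈ D_k  iff  (i,j) ∈ [m]×[n] and m - k = i - j  (i.e. i + k = m + j)
InDiag : (m n k : ℕ) → ℕ → ℕ → Set
InDiag m n k i j = InGrid m n i j × i + k ≡ m + j

InColorSet : (m n k : ℕ) {r : ℕ} → Coloring r → Fin r → Set
InColorSet m n k c col = ∃ λ i → ∃ λ j → InDiag m n k i j × c i j ≡ col

InDiff : (m n x : ℕ) {r : ℕ} → Coloring r → Fin r → Set
InDiff m n x c col = InColorSet m n x c col × ¬ InColorSet m n m c col

-- |c(D_x) \ c(D_m)| ≤ 1 : any two elements of this finite set coincide
AtMostOne : {r : ℕ} → (Fin r → Set) → Set
AtMostOne P = ∀ a b → P a → P b → a ≡ b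

{-# OPTIONS --safe #-}
module Submission where

-- Two points of the same diagonal D_x differ by a vector (t , t), and (t , t)
-- lies on the main diagonal D_m.  So if p and p + (t , t) on D_x had distinct
-- colours, both outside c(D_m), then p, (t , t) and their sum would form a
-- rainbow solution.  The argument needs no restriction on x.

open import Defs
open import Data.Nat using (ℕ; zero; suc; _+_; _∸_; _≤_; s≤s; z≤n)
open import Data.Nat.Properties
  using (+-assoc; +-comm; +-identityʳ; +-cancelˡ-≡; +-commutativeSemigroup;
         ≤-trans; ≤-total; m≤n+m; m≤n⇒∃[o]m+o≡n)
open import Algebra.Properties.CommutativeSemigroup +-commutativeSemigroup
  using (xy∙z≈xz∙y)
open import Data.Fin using (Fin)
open import Data.Fin.Properties using (_≟_)
open import Data.Product using (_,_; proj₁; proj₂)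
open import Data.Sum using (inj₁; inj₂)
open import Relation.Binary.PropositionalEquality
  using (_≡_; _≢_; refl; sym; cong; cong₂; module ≡-Reasoning)
open import Relation.Nullary using (¬_)
open import Relation.Nullary.Decidable using (decidable-stable)

sameDiagonal-step : ∀ {m x p₁ p₂ q₂} t →
  p₁ + x ≡ m + p₂ → p₁ + t + x ≡ m + q₂ → q₂ ≡ p₂ + t
sameDiagonal-step {m} {x} {p₁} {p₂} {q₂} t p∈D q∈D = +-cancelˡ-≡ m q₂ (p₂ + t) (begin
  m + q₂       ≡⟨ sym q∈D ⟩
  p₁ + t + x   ≡⟨ xy∙z≈xz∙y p₁ t x ⟩
  p₁ + x + t   ≡⟨ cong (_+ t) p∈D ⟩
  m + p₂ + t   ≡⟨ +-assoc m p₂ t ⟩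
  m + (p₂ + t) ∎)
  where open ≡-Reasoning

diagonal-InGrid : ∀ {m n t} → m ≤ n → 1 ≤ t → t ≤ m → InGrid m n t t
diagonal-InGrid m≤n 1≤t t≤m = (1≤t , t≤m) , (1≤t , ≤-trans t≤m m≤n)

diagonal-InDiag : ∀ {m n t} → m ≤ n → 1 ≤ t → t ≤ m → InDiag m n m t t
diagonal-InDiag {t = t} m≤n 1≤t t≤m = diagonal-InGrid m≤n 1≤t t≤m , +-comm t _

module _ {m n r : ℕ} {c : Coloring r} (m≤n : m ≤ n) (noRainbow : ¬ RainbowSolution m n c) where

  OffMain : Fin r → Set
  OffMain col = ¬ InColorSet m n m c col

  translate-preserves-offMainColour : ∀ {p₁ p₂} t → 1 ≤ t →
    InGrid m n p₁ p₂ → InGrid m n (p₁ + t) (p₂ + t) →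
    OffMain (c p₁ p₂) → OffMain (c (p₁ + t) (p₂ + t)) →
    c p₁ p₂ ≡ c (p₁ + t) (p₂ + t)
  translate-preserves-offMainColour {p₁} {p₂} t 1≤t p∈G p+t∈G p∉M p+t∉M =
    decidable-stable (_ ≟ _) λ p≢p+t →
      noRainbow (p₁ , p₂ , t , t , p∈G , diagonal-InGrid m≤n 1≤t t≤m , p+t∈G ,
        (λ p≡t → p∉M (t , t , t∈M , sym p≡t)) ,
        p≢p+t ,
        (λ t≡p+t → p+t∉M (t , t , t∈M , t≡p+t)))
    where
    t≤m : t ≤ m
    t≤m = ≤-trans (m≤n+m t p₁) (proj₂ (proj₁ p+t∈G))
    t∈M : InDiag m n m t t
    t∈M = diagonal-InDiag m≤n 1≤t t≤m

  sameDiagonal-offMainColour-≡ : ∀ {x p₁ p₂ q₁ q₂} →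
    InDiag m n x p₁ p₂ → InDiag m n x q₁ q₂ → p₁ ≤ q₁ →
    OffMain (c p₁ p₂) → OffMain (c q₁ q₂) → c p₁ p₂ ≡ c q₁ q₂
  sameDiagonal-offMainColour-≡ {x} {p₁} {p₂} {q₂ = q₂} (p∈G , p∈D) (q∈G , q∈D) p₁≤q₁ p∉M q∉M
    with m≤n⇒∃[o]m+o≡n p₁≤q₁
  ... | t , refl with sameDiagonal-step {x = x} {p₁} {p₂} {q₂} t p∈D q∈D
  ... | refl with t
  ...   | zero  = cong₂ c (sym (+-identityʳ p₁)) (sym (+-identityʳ p₂))
  ...   | suc s = translate-preserves-offMainColour (suc s) (s≤s z≤n) p∈G q∈G p∉M q∉M

lemma2p7 : (m n r : ℕ) → m ≤ n → (c : Coloring r) →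
    ¬ RainbowSolution m n c →
    (x : ℕ) → 1 ≤ x → x ≤ m + n ∸ 1 → x ≢ m →
    AtMostOne (InDiff m n x c)
lemma2p7 m n r m≤n c noRainbow x _ _ _ a b
  ((p₁ , p₂ , p∈Dx , refl) , a∉M) ((q₁ , q₂ , q∈Dx , refl) , b∉M)
  with ≤-total p₁ q₁
... | inj₁ p₁≤q₁ = sameDiagonal-offMainColour-≡ m≤n noRainbow p∈Dx q∈Dx p₁≤q₁ a∉M b∉M
... | inj₂ q₁≤p₁ = sym (sameDiagonal-offMainColour-≡ m≤n noRainbow q∈Dx p∈Dx q₁≤p₁ b∉M a∉M)
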